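{- For each Hessenberg function $h>(1,2,\ldots,n)$ there exists at least one Hessenberg function $h'$ adjacent to $h$ with both $h>h'$ and $\mathfrak{C}_h\subset\mathfrak{C}_{h'}$.
   Context: A Hessenberg function is an $n$-tuple $h=(h_1,\ldots,h_n)$ of integers with $i\le h_i\le n$ for all $i$ and $h_i\le h_{i+1}$ for $1\le i\le n-1$. Partial order: $h\le h'$ iff $h_i\le h'_i$ for all $i$; $h>h'$ means $h\ge h'$ and $h\neq h'$. Hessenberg functions $h>h'$ are adjacent if there is $i_0$ with $h'_{i_0}=h_{i_0}-1$ and $h'_i=h_i$ for all $i\ne i_0$. For $S\subseteq\{1,\ldots,n\}$, $e_d(S)$ is the sum of all squarefree monomials of degree $d$ in the variables $x_i$, $i\in S$ (with $e_0(S)=1$, $e_d(S)=0$ for $d<0$ or $d>|S|$), and $e_d(1,\ldots,m)$ means $S=\{1,\ldots,m\}$. $\mathfrak{C}_h$ is the set of polynomials $\{e_{h_i-r}(1,\ldots,h_i): 1\le i\le n,\ 0\le r\le i-1\}$ in $\mathbb{Z}[x_1,\ldots,x_n]$. -}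

module Defs where

open import Data.Nat using (ℕ; zero; suc; _+_; _∸_; _≤_; _<_; _≤ᵇ_; _≡ᵇ_)
open import Data.Bool using (Bool; true; false; _∧_; if_then_else_)
import Data.Fin
open import Data.Fin using (Fin; toℕ)
open import Data.Integer using (ℤ; +_)
open import Data.Product using (Σ; ∃; ∃-syntax; _×_; _,_)
open import Relation.Binary.PropositionalEquality using (_≡_)
open import Relation.Nullary using (¬_)

-- Hessenberg functions: h : Fin n → ℕ, where index i : Fin n stands for the
-- 1-based position toℕ i + 1.
IsHessenberg : (n : ℕ) → (Fin n → ℕ) → Set
IsHessenberg n h =
  (∀ i → suc (toℕ i) ≤ h i) × (∀ i → h i ≤ n) ×
  (∀ i j → toℕ i ≤ toℕ j → h i ≤ h j)

_≤H_ : {n : ℕ} → (Fin n → ℕ) → (Fin n → ℕ) → Set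
h ≤H h' = ∀ i → h i ≤ h' i

_>H_ : {n : ℕ} → (Fin n → ℕ) → (Fin n → ℕ) → Set
h >H h' = (h' ≤H h) × ¬ (∀ i → h i ≡ h' i)

idH : (n : ℕ) → Fin n → ℕ
idH n i = suc (toℕ i)

Adjacent : {n : ℕ} → (Fin n → ℕ) → (Fin n → ℕ) → Set
Adjacent h h' = ∃[ i₀ ] (suc (h' i₀) ≡ h i₀ × (∀ i → ¬ (i ≡ i₀) → h' i ≡ h i))

-- Polynomials in ℤ[x_1,...,x_n]: coefficient functions on exponent vectors
Monomial : ℕ → Set
Monomial n = Fin n → ℕ

Poly : ℕ → Set
Poly n = Monomial n → ℤ

_≈P_ : {n : ℕ} → Poly n → Poly n → Set
p ≈P q = ∀ α → p α ≡ q α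

deg : {n : ℕ} → Monomial n → ℕ
deg {zero} α = 0
deg {suc n} α = α Data.Fin.zero + deg (λ j → α (Data.Fin.suc j))

-- α is squarefree (all exponents ≤ 1) and supported on the variables
-- x_1..x_m (exponent 0 at every variable x_j with j > m)
sqfreeIn : {n : ℕ} → ℕ → Monomial n → Bool
sqfreeIn {zero} m α = true
sqfreeIn {suc n} zero α = (α Data.Fin.zero ≡ᵇ 0) ∧ sqfreeIn {n} zero (λ j → α (Data.Fin.suc j))
sqfreeIn {suc n} (suc m) α = (α Data.Fin.zero ≤ᵇ 1) ∧ sqfreeIn {n} m (λ j → α (Data.Fin.suc j))

-- e_d(1,...,m): the sum of all squarefree monomials of degree d in x_1..x_m,
-- given by its coefficient function
esym : (n d m : ℕ) → Poly n
esym n d m α = if sqfreeIn m α ∧ (deg α ≡ᵇ d) then + 1 else + 0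

-- membership in 𝔆_h = { e_{h_i - r}(1,...,h_i) : 1 ≤ i ≤ n, 0 ≤ r ≤ i-1 }
-- (i is 1-based position toℕ i + 1, so r ≤ i - 1 becomes r ≤ toℕ i)
InC : (n : ℕ) → (Fin n → ℕ) → Poly n → Set
InC n h p = ∃[ i ] ∃[ r ] (r ≤ toℕ i × p ≈P esym n (h i ∸ r) (h i))

_⊆C_ : {n : ℕ} → (Fin n → ℕ) → (Fin n → ℕ) → Set
_⊆C_ {n} h h' = ∀ (p : Poly n) → InC n h p → InC n h' p

-- A Hessenberg function h ≠ (1,…,n) cannot be strictly increasing (bounded by n, it would be the
-- identity), so some value is repeated.  Let i₀ be the first position of a repeated value and
-- i₁ > i₀ another position with h i₁ = h i₀.  Lowering h at i₀ by one keeps it Hessenberg,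
-- since h a < h i₀ for a < i₀ and h i₀ = h i₁ ≥ i₁ + 1 ≥ i₀ + 2.  Every generator
-- e_{h i₀ - r}(1,…,h i₀) with r ≤ i₀ lost at i₀ is still produced at i₁, where r ≤ i₁ and the
-- value is unchanged.
module Submission where

open import Defs
import Data.Nat as ℕ
open import Data.Nat using (ℕ; zero; suc; _∸_; _≤_; _<_; pred; s≤s; s≤s⁻¹; _<?_; NonZero; >-nonZero)
open import Data.Nat.Properties
  using (≤-refl; ≤-reflexive; ≤-trans; ≤-antisym; ≤-<-trans; <⇒≤; <⇒≢; ≤∧≢⇒<; ≮⇒≥; <⇒≤pred;
         pred[n]≤n; pred-mono-≤; pred-mono-<; suc-pred; 1+n≢n; m<n⇒0<n)
open import Data.Fin using (Fin; toℕ; zero; suc; inject₁; inject; fromℕ<; _≟_)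
open import Data.Fin.Properties using (toℕ-injective; toℕ-inject; toℕ-inject₁; toℕ-fromℕ<; ¬∀⟶∃¬; ¬∀⟶∃¬-smallest)
open import Data.Product using (∃-syntax; _×_; _,_)
open import Data.Empty using (⊥-elim)
open import Function using (_∘_)
open import Relation.Binary.PropositionalEquality using (_≡_; _≢_; refl; sym; trans; cong; subst)
open import Relation.Nullary using (yes; no)
open import Relation.Nullary.Decidable using (¬?; decidable-stable)

strictlyIncreasing⇒≗idH : ∀ m (h : Fin (suc m) → ℕ) →
  (∀ i → suc (toℕ i) ≤ h i) → (∀ i → h i ≤ suc m) → (∀ k → h (inject₁ k) < h (suc k)) →
  ∀ i → h i ≡ suc (toℕ i)
strictlyIncreasing⇒≗idH zero h low up _ zero = ≤-antisym (up zero) (low zero)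
strictlyIncreasing⇒≗idH (suc m) h low up incr = h≗idH
  where
  instance
    h∘suc-nonZero : ∀ {i} → NonZero (h (suc i))
    h∘suc-nonZero {i} = >-nonZero (m<n⇒0<n (low (suc i)))

  tail≗idH : ∀ i → pred (h (suc i)) ≡ suc (toℕ i)
  tail≗idH = strictlyIncreasing⇒≗idH m (pred ∘ h ∘ suc)
    (pred-mono-≤ ∘ low ∘ suc) (pred-mono-≤ ∘ up ∘ suc) (pred-mono-< ∘ incr ∘ suc)

  h∘suc≗idH : ∀ i → h (suc i) ≡ suc (suc (toℕ i))
  h∘suc≗idH i = trans (sym (suc-pred (h (suc i)))) (cong suc (tail≗idH i))

  h≗idH : ∀ i → h i ≡ suc (toℕ i)
  h≗idH zero = ≤-antisym (s≤s⁻¹ (subst (h zero <_) (h∘suc≗idH zero) (incr zero))) (low zero)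
  h≗idH (suc i) = h∘suc≗idH i

record FirstRepeat {n : ℕ} (h : Fin n → ℕ) : Set where
  field
    i₀ i₁  : Fin n
    i₀<i₁  : toℕ i₀ < toℕ i₁
    repeat : h i₀ ≡ h i₁
    first  : ∀ a → toℕ a < toℕ i₀ → h a < h i₀

firstRepeat-above-idH : ∀ {n} {h : Fin n → ℕ} → IsHessenberg n h → (rep : FirstRepeat h) →
  let open FirstRepeat rep in suc (toℕ i₀) < h i₀
firstRepeat-above-idH (low , _) rep = ≤-trans (s≤s i₀<i₁) (subst (_ ≤_) (sym repeat) (low i₁))
  where open FirstRepeat rep

inject-fromℕ< : ∀ {n} {i a : Fin n} (a<i : toℕ a < toℕ i) → inject (fromℕ< a<i) ≡ a
inject-fromℕ< a<i = toℕ-injective (trans (toℕ-inject _) (toℕ-fromℕ< a<i))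

repeat⇒firstRepeat : ∀ {n} (h : Fin n → ℕ) → (∀ a b → toℕ a ≤ toℕ b → h a ≤ h b) →
  ∀ i j → toℕ i < toℕ j → h i ≡ h j → FirstRepeat h
repeat⇒firstRepeat {n} h mono i j i<j hi≡hj
  with ¬∀⟶∃¬-smallest n (λ a → h a ≢ h j) (λ a → ¬? (h a ℕ.≟ h j)) (λ ≢hj → ≢hj i hi≡hj)
... | i₀ , ¬hi₀≢hj , before = record
  { i₀ = i₀ ; i₁ = j ; i₀<i₁ = ≤-<-trans i₀≤i i<j ; repeat = hi₀≡hj ; first = first }
  where
  hi₀≡hj : h i₀ ≡ h j
  hi₀≡hj = decidable-stable (h i₀ ℕ.≟ h j) ¬hi₀≢hj

  before-≢ : ∀ a → toℕ a < toℕ i₀ → h a ≢ h j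
  before-≢ a a<i₀ = subst (λ b → h b ≢ h j) (inject-fromℕ< a<i₀) (before (fromℕ< a<i₀))

  i₀≤i : toℕ i₀ ≤ toℕ i
  i₀≤i = ≮⇒≥ λ i<i₀ → before-≢ i i<i₀ hi≡hj

  first : ∀ a → toℕ a < toℕ i₀ → h a < h i₀
  first a a<i₀ = ≤∧≢⇒< (mono a i₀ (<⇒≤ a<i₀)) λ ha≡hi₀ → before-≢ a a<i₀ (trans ha≡hi₀ hi₀≡hj)

>idH⇒firstRepeat : ∀ {n} {h : Fin n → ℕ} → IsHessenberg n h → h >H idH n → FirstRepeat h
>idH⇒firstRepeat {zero} _ (_ , h≢idH) = ⊥-elim (h≢idH λ ())
>idH⇒firstRepeat {suc m} {h} (low , up , mono) (_ , h≢idH)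
  with ¬∀⟶∃¬ m (λ k → h (inject₁ k) < h (suc k)) (λ k → h (inject₁ k) <? h (suc k))
         (h≢idH ∘ strictlyIncreasing⇒≗idH m h low up)
... | k , h[k]≮h[k+1] = repeat⇒firstRepeat h mono (inject₁ k) (suc k) k<k+1
        (≤-antisym (mono (inject₁ k) (suc k) (<⇒≤ k<k+1)) (≮⇒≥ h[k]≮h[k+1]))
  where
  k<k+1 : toℕ (inject₁ k) < toℕ (suc k)
  k<k+1 = s≤s (≤-reflexive (toℕ-inject₁ k))

IsGenerator : ∀ {n} → Poly n → ℕ → ℕ → Set
IsGenerator {n} p r x = p ≈P esym n (x ∸ r) x

lowerAt : ∀ {n} → Fin n → (Fin n → ℕ) → Fin n → ℕ
lowerAt i₀ h i with i ≟ i₀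
... | yes _ = pred (h i)
... | no _  = h i

module _ {n : ℕ} {i₀ : Fin n} {h : Fin n → ℕ} where

  lowerAt-self : lowerAt i₀ h i₀ ≡ pred (h i₀)
  lowerAt-self with i₀ ≟ i₀
  ... | yes _     = refl
  ... | no i₀≢i₀ = ⊥-elim (i₀≢i₀ refl)

  lowerAt-other : ∀ {i} → i ≢ i₀ → lowerAt i₀ h i ≡ h i
  lowerAt-other {i} i≢i₀ with i ≟ i₀
  ... | yes i≡i₀ = ⊥-elim (i≢i₀ i≡i₀)
  ... | no _     = refl

  lowerAt-≤H : lowerAt i₀ h ≤H h
  lowerAt-≤H i with i ≟ i₀
  ... | yes _ = pred[n]≤n
  ... | no _  = ≤-refl

  suc-lowerAt-self : .{{NonZero (h i₀)}} → suc (lowerAt i₀ h i₀) ≡ h i₀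
  suc-lowerAt-self = trans (cong suc lowerAt-self) (suc-pred (h i₀))

  lowerAt-adjacent : .{{NonZero (h i₀)}} → Adjacent h (lowerAt i₀ h)
  lowerAt-adjacent = i₀ , suc-lowerAt-self , λ _ → lowerAt-other

  lowerAt-<H : .{{NonZero (h i₀)}} → h >H lowerAt i₀ h
  lowerAt-<H = lowerAt-≤H , λ h≗lowerAt → 1+n≢n (trans suc-lowerAt-self (h≗lowerAt i₀))

  lowerAt-isHessenberg : IsHessenberg n h → suc (toℕ i₀) < h i₀ →
    (∀ a → toℕ a < toℕ i₀ → h a < h i₀) → IsHessenberg n (lowerAt i₀ h)
  lowerAt-isHessenberg (low , up , mono) i₀<h[i₀] first = low′ , up′ , mono′
    where
    low′ : ∀ i → suc (toℕ i) ≤ lowerAt i₀ h i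
    low′ i with i ≟ i₀
    ... | yes refl = <⇒≤pred i₀<h[i₀]
    ... | no _     = low i

    up′ : ∀ i → lowerAt i₀ h i ≤ n
    up′ i = ≤-trans (lowerAt-≤H i) (up i)

    mono′ : ∀ i j → toℕ i ≤ toℕ j → lowerAt i₀ h i ≤ lowerAt i₀ h j
    mono′ i j i≤j with i ≟ i₀ | j ≟ i₀
    ... | yes _   | yes _    = pred-mono-≤ (mono i j i≤j)
    ... | yes _   | no _     = ≤-trans pred[n]≤n (mono i j i≤j)
    ... | no i≢i₀ | yes refl = <⇒≤pred (first i (≤∧≢⇒< i≤j (i≢i₀ ∘ toℕ-injective)))
    ... | no _    | no _     = mono i j i≤j

  ⊆C-lowerAt : ∀ {i₁} → toℕ i₀ < toℕ i₁ → h i₀ ≡ h i₁ → h ⊆C lowerAt i₀ h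
  ⊆C-lowerAt {i₁} i₀<i₁ h[i₀]≡h[i₁] p (i , r , r≤i , p≈e) with i ≟ i₀
  ... | no i≢i₀  = i , r , r≤i , subst (IsGenerator p r) (sym (lowerAt-other i≢i₀)) p≈e
  ... | yes refl = i₁ , r , ≤-trans r≤i (<⇒≤ i₀<i₁) ,
                   subst (IsGenerator p r) (trans h[i₀]≡h[i₁] (sym (lowerAt-other i₁≢i₀))) p≈e
    where
    i₁≢i₀ : i₁ ≢ i₀
    i₁≢i₀ i₁≡i₀ = <⇒≢ i₀<i₁ (cong toℕ (sym i₁≡i₀))

theorem4p12 : (n : ℕ) (h : Fin n → ℕ) → IsHessenberg n h → h >H idH n →
    ∃[ h' ] (IsHessenberg n h' × Adjacent h h' × h >H h' × h ⊆C h')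
theorem4p12 n h H h>idH =
  lowerAt i₀ h , lowerAt-isHessenberg H i₀<h[i₀] first , lowerAt-adjacent , lowerAt-<H ,
  ⊆C-lowerAt i₀<i₁ repeat
  where
  rep : FirstRepeat h
  rep = >idH⇒firstRepeat H h>idH
  open FirstRepeat rep

  i₀<h[i₀] : suc (toℕ i₀) < h i₀
  i₀<h[i₀] = firstRepeat-above-idH H rep

  instance
    h[i₀]-nonZero : NonZero (h i₀)
    h[i₀]-nonZero = >-nonZero (m<n⇒0<n i₀<h[i₀])
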